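{- Let $k$ be a non-zero integer and $B$ a positive integer, and let $P=(c,d)\in\mathbb{Z}^2$ satisfy $d^2=c^3+kB^2$. Let $f_P(x,y)=x^3-3cxy^2+2dy^3$. Let $M$ be a positive integer dividing $B$ with $\gcd(M,c)=1$. Then there exists an integer $w\neq 0$ such that \[F_P(x,y)\coloneqq \frac{1}{M^2}\, f_P\!\left((x,y)\cdot \begin{pmatrix} M & 0\\ w & 1\end{pmatrix}\right)=\frac{1}{M^2}f_P(Mx+wy,\,y)\] is an integer-matrix binary cubic form. Moreover $F_P(1,0)=M$ and $\Delta(F_P)=-\frac{4kB^2}{M^2}$.
   Context: An integer-matrix binary cubic form is $ax^3+3bx^2y+3cxy^2+dy^3$ with $a,b,c,d\in\mathbb{Z}$; its discriminant is $\Delta=3b^2c^2-4ac^3-4b^3d-a^2d^2+6abcd$. -}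

module Defs where

open import Data.Integer using (ℤ; +_; _+_; _-_; _*_; -_)

-- An integer-matrix binary cubic form  a x^3 + 3 b x^2 y + 3 c x y^2 + d y^3
record CubicForm : Set where
  constructor form
  field
    a b c d : ℤ

open CubicForm public

cube : ℤ → ℤ
cube x = x * x * x

sq : ℤ → ℤ
sq x = x * x

evalForm : CubicForm → ℤ → ℤ → ℤ
evalForm F x y =
  a F * cube x + + 3 * b F * sq x * y + + 3 * c F * x * sq y + d F * cube y

disc : CubicForm → ℤ
disc F =
  + 3 * sq (b F) * sq (c F) - + 4 * a F * cube (c F) - + 4 * cube (b F) * d F
  - sq (a F) * sq (d F) + + 6 * a F * b F * c F * d F

fP : ℤ → ℤ → ℤ → ℤ → ℤ
fP c d x y = cube x - + 3 * c * x * sq y + + 2 * d * cube y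

-- Mod M², the point (c , d) lies on the cusp y² = x³, since M² ∣ k B²; as c is a unit mod M²,
-- this cusp point is (w², w³) for w ≡ d / c. Substituting x ↦ M x + w y in f_P, the congruences
-- w² ≡ c and c w ≡ d are exactly what makes every coefficient divisible by M² (after the
-- factors 3 of the x²y and xy² terms are set aside). The substitution has determinant M, so the
-- discriminant 4 (c³ − d²) = −4 k B² of f_P is multiplied by M⁶ / (M²)⁴ = M⁻².
module Submission where

open import Defs
open import Data.Integer using (ℤ; +_; _+_; _-_; _*_; -_; _<_)
open import Data.Integer.Divisibility using (_∣_)
open import Data.Integer.GCD using (gcd)
open import Data.Product using (Σ; _×_; _,_)
open import Relation.Binary.PropositionalEquality using (_≡_; _≢_)

open import Data.Integer using (∣_∣; -[1+_]; +<+; _≟_)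
open import Data.Integer.Properties
  using (+-injective; pos-*; +-minus-telescope; +∣i∣≡i⊎+∣i∣≡-i; neg-distribˡ-*; *-identityʳ; *-comm)
open import Data.Integer.Divisibility.Signed as Signed
  using (divides; ∣ᵤ⇒∣; ∣-trans; m∣∣m∣; ∣m∣n⇒∣m+n; ∣m⇒∣-m; ∣n⇒∣m*n; ∣m⇒∣m*n; *-monoʳ-∣; *-monoˡ-∣)
open import Data.Integer.Tactic.RingSolver using (solve-∀)
import Data.Nat as ℕ
open import Data.Nat.Coprimality using (Coprime; coprime-Bézout; gcd≡1⇒coprime)
open import Data.Nat.GCD using (module Bézout)
open import Data.Sum using (inj₁; inj₂)
open import Level using (0ℓ)
open import Relation.Binary.Bundles using (Setoid)
import Relation.Binary.Reasoning.Setoid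
open import Relation.Binary.PropositionalEquality using (refl; sym; trans; cong; subst; module ≡-Reasoning)
open import Relation.Nullary using (yes; no)

infix 4 _≡_[mod_]

-- A record rather than a synonym for n ∣ x - y, so that x, y and n are inferable from its type.
record _≡_[mod_] (x y n : ℤ) : Set where
  constructor ≡mod
  field n∣x-y : n Signed.∣ x - y

module _ {n : ℤ} where

  ≡mod-reflexive : ∀ {x y} → x ≡ y → x ≡ y [mod n ]
  ≡mod-reflexive {x} refl = ≡mod (divides (+ 0) (x-x≡0*n x n))
    where
    x-x≡0*n : ∀ x n → x - x ≡ + 0 * n
    x-x≡0*n = solve-∀

  ≡mod-sym : ∀ {x y} → x ≡ y [mod n ] → y ≡ x [mod n ]
  ≡mod-sym {x} {y} (≡mod n∣x-y) = ≡mod (subst (n Signed.∣_) (-[x-y]≡y-x x y) (∣m⇒∣-m n∣x-y))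
    where
    -[x-y]≡y-x : ∀ x y → - (x - y) ≡ y - x
    -[x-y]≡y-x = solve-∀

  ≡mod-trans : ∀ {x y z} → x ≡ y [mod n ] → y ≡ z [mod n ] → x ≡ z [mod n ]
  ≡mod-trans {x} {y} {z} (≡mod n∣x-y) (≡mod n∣y-z) =
    ≡mod (subst (n Signed.∣_) (+-minus-telescope x y z) (∣m∣n⇒∣m+n n∣x-y n∣y-z))

  ≡mod-*-cong : ∀ {x y u v} → x ≡ y [mod n ] → u ≡ v [mod n ] → x * u ≡ y * v [mod n ]
  ≡mod-*-cong {x} {y} {u} {v} (≡mod n∣x-y) (≡mod n∣u-v) =
    ≡mod (subst (n Signed.∣_) (split x y u v) (∣m∣n⇒∣m+n (∣m⇒∣m*n u n∣x-y) (∣n⇒∣m*n y n∣u-v)))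
    where
    split : ∀ x y u v → (x - y) * u + y * (u - v) ≡ x * u - y * v
    split = solve-∀

  ≡mod-*-congˡ : ∀ x {u v} → u ≡ v [mod n ] → x * u ≡ x * v [mod n ]
  ≡mod-*-congˡ x = ≡mod-*-cong (≡mod-reflexive {x} refl)

  ≡mod-*-congʳ : ∀ u {x y} → x ≡ y [mod n ] → x * u ≡ y * u [mod n ]
  ≡mod-*-congʳ u x≡y = ≡mod-*-cong x≡y (≡mod-reflexive {u} refl)

  ≡mod-+-multiple : ∀ {x z} → n Signed.∣ z → x + z ≡ x [mod n ]
  ≡mod-+-multiple {x} {z} n∣z = ≡mod (subst (n Signed.∣_) (z≡x+z-x x z) n∣z)
    where
    z≡x+z-x : ∀ x z → z ≡ x + z - x
    z≡x+z-x = solve-∀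

  ≡mod-setoid : Setoid 0ℓ 0ℓ
  ≡mod-setoid = record
    { _≈_           = _≡_[mod n ]
    ; isEquivalence = record { refl = ≡mod-reflexive refl ; sym = ≡mod-sym ; trans = ≡mod-trans }
    }

module ≡mod-Reasoning (n : ℤ) = Relation.Binary.Reasoning.Setoid (≡mod-setoid {n})

≡mod-∣ : ∀ {m n x y} → m Signed.∣ n → x ≡ y [mod n ] → x ≡ y [mod m ]
≡mod-∣ m∣n (≡mod n∣x-y) = ≡mod (∣-trans m∣n n∣x-y)

pos-1+*≡* : ∀ x y m n → 1 ℕ.+ y ℕ.* n ≡ x ℕ.* m → + 1 + + y * + n ≡ + x * + m
pos-1+*≡* x y m n eq = trans (cong (λ t → + 1 + t) (sym (pos-* y n))) (trans (cong +_ eq) (pos-* x m))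

ℕ-coprime⇒invertible : ∀ {m n} → Coprime m n → Σ ℤ λ v → + n * v ≡ + 1 [mod + m ]
ℕ-coprime⇒invertible {m} {n} coprime with coprime-Bézout coprime
... | Bézout.+- x y eq = - + y , ≡mod (divides (- + x) (begin
  + n * - + y - + 1       ≡⟨ rearrange (+ n) (+ y) ⟩
  - (+ 1 + + y * + n)     ≡⟨ cong -_ (pos-1+*≡* x y m n eq) ⟩
  - (+ x * + m)           ≡⟨ neg-distribˡ-* (+ x) (+ m) ⟩
  - + x * + m             ∎))
  where
  open ≡-Reasoning
  rearrange : ∀ n y → n * - y - + 1 ≡ - (+ 1 + y * n)
  rearrange = solve-∀
... | Bézout.-+ x y eq = + y , ≡mod (divides (+ x) (begin
  + n * + y - + 1         ≡⟨ cong (_- + 1) (*-comm (+ n) (+ y)) ⟩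
  + y * + n - + 1         ≡⟨ cong (_- + 1) (pos-1+*≡* y x n m eq) ⟨
  + 1 + + x * + m - + 1   ≡⟨ cancel (+ x * + m) ⟩
  + x * + m               ∎))
  where
  open ≡-Reasoning
  cancel : ∀ z → + 1 + z - + 1 ≡ z
  cancel = solve-∀

coprime⇒invertible : ∀ m c → gcd m c ≡ + 1 → Σ ℤ λ v → c * v ≡ + 1 [mod m ]
coprime⇒invertible m c gcd≡1
  with v , ∣c∣v≡1 ← ℕ-coprime⇒invertible (gcd≡1⇒coprime (+-injective gcd≡1))
  with +∣i∣≡i⊎+∣i∣≡-i c
... | inj₁ ∣c∣≡c  = v , ≡mod-∣ m∣∣m∣ (subst (_≡ + 1 [mod + ∣ m ∣ ]) (cong (_* v) ∣c∣≡c) ∣c∣v≡1)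
... | inj₂ ∣c∣≡-c = - v , ≡mod-∣ m∣∣m∣
                           (subst (_≡ + 1 [mod + ∣ m ∣ ]) (trans (cong (_* v) ∣c∣≡-c) (-c*v≡c*-v c v)) ∣c∣v≡1)
  where
  -c*v≡c*-v : ∀ c v → - c * v ≡ c * - v
  -c*v≡c*-v = solve-∀

-- Newton step: 1 − c v′ = (1 − c v)² for v′ = 2 v − c v².
inverse-mod-square : ∀ {n} c v → c * v ≡ + 1 [mod n ] → c * (+ 2 * v - c * v * v) ≡ + 1 [mod n * n ]
inverse-mod-square {n} c v (≡mod (divides q cv-1≡qn)) = ≡mod (divides (- (q * q)) (begin
  c * (+ 2 * v - c * v * v) - + 1   ≡⟨ newton c v ⟩
  - ((c * v - + 1) * (c * v - + 1)) ≡⟨ cong (λ t → - (t * t)) cv-1≡qn ⟩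
  - (q * n * (q * n))               ≡⟨ regroup q n ⟩
  - (q * q) * (n * n)               ∎))
  where
  open ≡-Reasoning
  newton : ∀ c v → c * (+ 2 * v - c * v * v) - + 1 ≡ - ((c * v - + 1) * (c * v - + 1))
  newton = solve-∀
  regroup : ∀ q n → - (q * n * (q * n)) ≡ - (q * q) * (n * n)
  regroup = solve-∀

nonzero-representative : ∀ {n} → n ≢ + 0 → ∀ x → Σ ℤ λ w → w ≢ + 0 × w ≡ x [mod n ]
nonzero-representative {n} n≢0 x with x ≟ + 0
... | no x≢0   = x , x≢0 , ≡mod-reflexive refl
... | yes refl = n , n≢0 , ≡mod (divides (+ 1) (n-0≡1*n n))
  where
  n-0≡1*n : ∀ n → n - + 0 ≡ + 1 * n
  n-0≡1*n = solve-∀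

-- The cusp y² = x³ is parametrised by t ↦ (t², t³), and a point (c , d) with c a unit has t = d / c.
cusp-parameter : ∀ {n} c d v → c * v ≡ + 1 [mod n ] → d * d ≡ c * c * c [mod n ] →
                 (d * v) * (d * v) ≡ c [mod n ] × c * (d * v) ≡ d [mod n ]
cusp-parameter {n} c d v cv≡1 onCusp = square , ratio
  where
  open ≡mod-Reasoning n
  square : (d * v) * (d * v) ≡ c [mod n ]
  square = begin
    (d * v) * (d * v)       ≡⟨ interchange d v ⟩
    (d * d) * (v * v)       ≈⟨ ≡mod-*-congʳ (v * v) onCusp ⟩
    c * c * c * (v * v)     ≡⟨ regroup c v ⟩
    c * ((c * v) * (c * v)) ≈⟨ ≡mod-*-congˡ c (≡mod-*-cong cv≡1 cv≡1) ⟩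
    c * + 1                 ≡⟨ *-identityʳ c ⟩
    c                       ∎
    where
    interchange : ∀ d v → (d * v) * (d * v) ≡ (d * d) * (v * v)
    interchange = solve-∀
    regroup : ∀ c v → c * c * c * (v * v) ≡ c * ((c * v) * (c * v))
    regroup = solve-∀
  ratio : c * (d * v) ≡ d [mod n ]
  ratio = begin
    c * (d * v)   ≡⟨ swap c d v ⟩
    d * (c * v)   ≈⟨ ≡mod-*-congˡ d cv≡1 ⟩
    d * + 1       ≡⟨ *-identityʳ d ⟩
    d             ∎
    where
    swap : ∀ c d v → c * (d * v) ≡ d * (c * v)
    swap = solve-∀

nonzero-cusp-parameter : ∀ {n} c d v → n ≢ + 0 → c * v ≡ + 1 [mod n ] → d * d ≡ c * c * c [mod n ] →
                         Σ ℤ λ w → w ≢ + 0 × w * w ≡ c [mod n ] × c * w ≡ d [mod n ]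
nonzero-cusp-parameter {n} c d v n≢0 cv≡1 onCusp
  with w , w≢0 , w≡dv ← nonzero-representative n≢0 (d * v) =
  let t²≡c , ct≡d = cusp-parameter c d v cv≡1 onCusp in
  w , w≢0 , ≡mod-trans (≡mod-*-cong w≡dv w≡dv) t²≡c , ≡mod-trans (≡mod-*-congˡ c w≡dv) ct≡d

on-cusp-mod : ∀ k B c d {M} → d * d ≡ c * c * c + k * (B * B) → M Signed.∣ B →
              d * d ≡ c * c * c [mod M * M ]
on-cusp-mod k B c d {M} onCurve M∣B =
  ≡mod-trans (≡mod-reflexive onCurve)
             (≡mod-+-multiple (∣n⇒∣m*n k (∣-trans (*-monoʳ-∣ M M∣B) (*-monoˡ-∣ B M∣B))))

shearedForm : (M w g h : ℤ) → CubicForm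
shearedForm M w g h = form M w (M * g) (w * g - + 2 * h)

shearedForm-eval : ∀ M w g h x y → let c = w * w - g * (M * M) in
  M * M * evalForm (shearedForm M w g h) x y ≡ fP c (c * w - h * (M * M)) (M * x + w * y) y
shearedForm-eval = expanded
  where
  -- The ring solver does not unfold evalForm and fP, so the goal is restated unfolded.
  expanded : ∀ M w g h x y →
    let a = M ; b = w ; c′ = M * g ; d′ = w * g - + 2 * h
        c = w * w - g * (M * M) ; d = c * w - h * (M * M) ; X = M * x + w * y in
    M * M * (a * (x * x * x) + + 3 * b * (x * x) * y + + 3 * c′ * x * (y * y) + d′ * (y * y * y))
      ≡ X * X * X - + 3 * c * X * (y * y) + + 2 * d * (y * y * y)
  expanded = solve-∀

shearedForm-disc : ∀ M w g h → let c = w * w - g * (M * M) ; d = c * w - h * (M * M) in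
  M * M * disc (shearedForm M w g h) ≡ - (+ 4 * (d * d - c * c * c))
shearedForm-disc = expanded
  where
  expanded : ∀ M w g h →
    let a = M ; b = w ; c′ = M * g ; d′ = w * g - + 2 * h
        c = w * w - g * (M * M) ; d = c * w - h * (M * M) in
    M * M * (+ 3 * (b * b) * (c′ * c′) - + 4 * a * (c′ * c′ * c′) - + 4 * (b * b * b) * d′
             - (a * a) * (d′ * d′) + + 6 * a * b * c′ * d′)
      ≡ - (+ 4 * (d * d - c * c * c))
  expanded = solve-∀

evalForm-1-0 : ∀ F → evalForm F (+ 1) (+ 0) ≡ a F
evalForm-1-0 F = expanded (a F) (b F) (c F) (d F)
  where
  expanded : ∀ a b c d →
    a * (+ 1 * + 1 * + 1) + + 3 * b * (+ 1 * + 1) * + 0 + + 3 * c * + 1 * (+ 0 * + 0) + d * (+ 0 * + 0 * + 0) ≡ a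
  expanded = solve-∀

i-j≡k⇒j≡i-k : ∀ i j {k} → i - j ≡ k → j ≡ i - k
i-j≡k⇒j≡i-k i j refl = j≡i-[i-j] i j
  where
  j≡i-[i-j] : ∀ i j → j ≡ i - (i - j)
  j≡i-[i-j] = solve-∀

integral-shear : ∀ M w c d → w * w ≡ c [mod M * M ] → c * w ≡ d [mod M * M ] →
  Σ CubicForm λ F → ((x y : ℤ) → M * M * evalForm F x y ≡ fP c d (M * x + w * y) y)
                    × evalForm F (+ 1) (+ 0) ≡ M
                    × M * M * disc F ≡ - (+ 4 * (d * d - c * c * c))
integral-shear M w c d (≡mod (divides g w²-c≡gM²)) (≡mod (divides h cw-d≡hM²))
  with refl ← i-j≡k⇒j≡i-k (w * w) c w²-c≡gM²
  with refl ← i-j≡k⇒j≡i-k (c * w) d cw-d≡hM² =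
  shearedForm M w g h , shearedForm-eval M w g h ,
  evalForm-1-0 (shearedForm M w g h) , shearedForm-disc M w g h

discriminant-on-curve : ∀ k B c d → d * d ≡ c * c * c + k * (B * B) →
                        - (+ 4 * (d * d - c * c * c)) ≡ - (+ 4 * k * (B * B))
discriminant-on-curve k B c d onCurve = begin
  - (+ 4 * (d * d - c * c * c))                   ≡⟨ cong (λ t → - (+ 4 * (t - c * c * c))) onCurve ⟩
  - (+ 4 * (c * c * c + k * (B * B) - c * c * c)) ≡⟨ cancel c k B ⟩
  - (+ 4 * k * (B * B))                           ∎
  where
  open ≡-Reasoning
  cancel : ∀ c k B → - (+ 4 * (c * c * c + k * (B * B) - c * c * c)) ≡ - (+ 4 * k * (B * B))
  cancel = solve-∀

lemma4p1 : (k B c d M : ℤ) → k ≢ + 0 → + 0 < B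
    → d * d ≡ c * c * c + k * (B * B)
    → + 0 < M → M ∣ B → gcd M c ≡ + 1
    → Σ ℤ λ w → w ≢ + 0 × Σ CubicForm λ F
        → ((x y : ℤ) → M * M * evalForm F x y ≡ fP c d (M * x + w * y) y)
          × evalForm F (+ 1) (+ 0) ≡ M
          × M * M * disc F ≡ - (+ 4 * k * (B * B))
lemma4p1 k B c d M@(+ ℕ.suc _) _ _ onCurve _ M∣B gcd≡1 =
  let v , cv≡1 = coprime⇒invertible M c gcd≡1
      v′ = + 2 * v - c * v * v
      w , w≢0 , w²≡c , cw≡d = nonzero-cusp-parameter c d v′ (λ ()) (inverse-mod-square c v cv≡1)
                                         (on-cusp-mod k B c d {M} onCurve (∣ᵤ⇒∣ M∣B))
      F , eval , F[1,0]≡M , disc≡ = integral-shear M w c d w²≡c cw≡d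
  in w , w≢0 , F , eval , F[1,0]≡M , trans disc≡ (discriminant-on-curve k B c d onCurve)
lemma4p1 _ _ _ _ (+ 0) _ _ _ (+<+ ()) _ _
lemma4p1 _ _ _ _ -[1+ _ ] _ _ _ () _ _
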